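{- For any finite set $X$, $$d_X=|X|-\min_{l\vdash|X|}\ \max_{1\le k\le|X|}k\,l_k,$$ where $l=(l_1,\dots,l_{|X|})$ runs over the numerical partitions of $|X|$, i.e. tuples of nonnegative integers with $\sum_{k=1}^{|X|}k\,l_k=|X|$.
   Context: For a partition $\pi$ of $X$ and $\alpha\in S_X$, let $S(i)=\ln$ of the size of the block of $\pi$ containing $i$ and $D(X,\pi,\alpha)=\{i\in X: S(\alpha(i))<S(i)\}$. Define $d_X=\max_{\pi\in\mathrm{Par}X,\ \alpha\in S_X}|D(X,\pi,\alpha)|$. -}

module Defs where

open import Data.Nat using (ℕ; suc; _*_; _⊔_; _<?_; _≤_; _∸_)
open import Data.Fin using (Fin; toℕ)
open import Data.Fin.Properties using () renaming (_≟_ to _≟ᶠ_)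
open import Data.Fin.Permutation using (Permutation′; _⟨$⟩ʳ_)
open import Data.List using (List; length; filter; map; foldr; allFin)
open import Data.Nat.ListAction using (sum)
open import Data.Product using (Σ; ∃; ∃-syntax; _×_)
open import Relation.Binary.PropositionalEquality using (_≡_)

-- A set partition π of X = Fin n is represented by a block-labelling
-- function f : Fin n → Fin n; the block of i is {j | f j ≡ f i}.
-- Every partition of Fin n (which has at most n blocks) arises this way.
SetPartition : ℕ → Set
SetPartition n = Fin n → Fin n

blockSize : ∀ {n} → SetPartition n → Fin n → ℕ
blockSize {n} π i = length (filter (λ j → π j ≟ᶠ π i) (allFin n))

-- |D(X, π, α)| where D = {i : S(α i) < S(i)}, S(i) = ln(blockSize π i).
-- Since ln is strictly increasing, S(α i) < S(i) ⟺ blockSize (α i) < blockSize i.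
Dcard : ∀ {n} → SetPartition n → Permutation′ n → ℕ
Dcard {n} π α =
  length (filter (λ i → blockSize π (α ⟨$⟩ʳ i) <? blockSize π i) (allFin n))

IsDX : ℕ → ℕ → Set
IsDX n d = (∀ (π : SetPartition n) (α : Permutation′ n) → Dcard π α ≤ d)
         × (∃[ π ] ∃[ α ] Dcard {n} π α ≡ d)

-- Numerical partition of n: l = (l_1,…,l_n), l_k = l (k-1), with Σ k l_k = n.
IsNumPartition : (n : ℕ) → (Fin n → ℕ) → Set
IsNumPartition n l = sum (map (λ k → suc (toℕ k) * l k) (allFin n)) ≡ n

maxKL : (n : ℕ) → (Fin n → ℕ) → ℕ
maxKL n l = foldr _⊔_ 0 (map (λ k → suc (toℕ k) * l k) (allFin n))

IsMinMaxKL : ℕ → ℕ → Set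
IsMinMaxKL n m = (∀ (l : Fin n → ℕ) → IsNumPartition n l → m ≤ maxKL n l)
               × (∃[ l ] (IsNumPartition n l × maxKL n l ≡ m))

module Submission where

-- For a set partition π of X = Fin n and a permutation α, let v = blockSize π;
-- D(X, π, α) is the set of descents of v along α, the i with v (α i) < v i.
--
-- For every value s, #{i | v i = s} + #descents ≤ n: a descent
-- i with v (α i) ≥ s has v i > s, and α preserves #{i | v i ≥ s}.  If l is the
-- type of π (l_k = number of blocks of size k), then #{i | v i = k} = k·l_k
-- and l is a numerical partition of n, so |D| ≤ n − max_k k·l_k ≤ n − m,
-- where m is the min-max over numerical partitions.  The minimum m exists
-- because parts of numerical partitions of n are ≤ n (finite minimisation).
--
-- For a numerical partition l with M = max_k k·l_k, cut [0, n)
-- into consecutive segments of lengths 1·l_1, 2·l_2, … and segment k into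
-- blocks of size k, and rotate by i ↦ i − M (mod n).  Segments are shorter
-- than M, so each i ≥ M lands in a smaller block: at least n − M descents.
-- Applied to a minimiser this attains n − m.

open import Defs
open import Data.Nat using (ℕ; _∸_)
open import Data.Product using (∃-syntax; _×_)

open import Data.Bool using (true; false)
open import Data.Nat using (zero; suc; _+_; _*_; _≤_; _<_; _⊔_; _<?_; _≤?_; _≟_; z≤n; s≤s; NonZero)
open import Data.Nat.DivMod
  using (_/_; _%_; m%n<n; %-distribˡ-+; m%n%n≡m%n; [m+n]%n≡m%n; m<n⇒m%n≡m; +-distrib-/-∣ˡ; m*n/n≡m; m<n⇒m/n≡0;
         m<n*o⇒m/o<n; m≡m%n+[m/n]*n)
open import Data.Nat.Divisibility using (n∣m*n)
open import Data.Nat.Properties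
open import Data.Nat.ListAction using () renaming (sum to sumˡ)
open import Data.Fin using (Fin; toℕ; fromℕ<) renaming (zero to fz; suc to fs)
open import Data.Fin.Properties using (toℕ-injective; toℕ<n; toℕ-fromℕ<) renaming (_≟_ to _≟ᶠ_; suc-injective to fs-injective)
open import Data.Fin.Permutation as Perm using (Permutation′; _⟨$⟩ʳ_; permutation)
open import Data.List using (length; filter; map; foldr; allFin; tabulate)
open import Data.List.Properties using (map-tabulate; map-cong)
open import Data.Product using (Σ; _,_; proj₁; proj₂; map₁)
open import Data.Sum using (inj₁; inj₂)
open import Function using (_∘_; id)
open import Relation.Nullary using (Dec; _because_; yes; no; ¬_; contradiction)
open import Relation.Nullary.Decidable using (_×-dec_)
open import Relation.Unary using (Pred; Decidable)
open import Relation.Binary.PropositionalEquality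
open import Algebra.Properties.Semiring.Sum +-*-semiring
  using (sum-syntax; sum-cong-≗; sum-replicate-zero; ∑-distrib-+; ∑-comm; ∑-permute;
         *-distribˡ-sum; *-distribʳ-sum)

𝟙 : ∀ {p} {P : Set p} → Dec P → ℕ
𝟙 (true  because _) = 1
𝟙 (false because _) = 0

𝟙≤1 : ∀ {p} {P : Set p} (d : Dec P) → 𝟙 d ≤ 1
𝟙≤1 (yes _) = s≤s z≤n
𝟙≤1 (no _)  = z≤n

𝟙-yes : ∀ {p} {P : Set p} (d : Dec P) → P → 𝟙 d ≡ 1
𝟙-yes (yes _) _  = refl
𝟙-yes (no ¬p) p  = contradiction p ¬p

𝟙-no : ∀ {p} {P : Set p} (d : Dec P) → ¬ P → 𝟙 d ≡ 0
𝟙-no (yes p) ¬p = contradiction p ¬p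
𝟙-no (no _)  _  = refl

𝟙-cong : ∀ {p q} {P : Set p} {Q : Set q} (d : Dec P) (e : Dec Q) →
         (P → Q) → (Q → P) → 𝟙 d ≡ 𝟙 e
𝟙-cong (yes p) e        f g = sym (𝟙-yes e (f p))
𝟙-cong (no ¬p) e        f g = sym (𝟙-no e (¬p ∘ g))

𝟙-mono : ∀ {p q} {P : Set p} {Q : Set q} (d : Dec P) (e : Dec Q) → (P → Q) → 𝟙 d ≤ 𝟙 e
𝟙-mono (yes p) e P→Q = ≤-reflexive (sym (𝟙-yes e (P→Q p)))
𝟙-mono (no _)  e P→Q = z≤n

∑-mono : ∀ n {f g : Fin n → ℕ} → (∀ i → f i ≤ g i) → ∑[ i < n ] f i ≤ ∑[ i < n ] g i
∑-mono zero    f≤g = z≤n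
∑-mono (suc n) f≤g = +-mono-≤ (f≤g fz) (∑-mono n (f≤g ∘ fs))

∑-ones : ∀ n → ∑[ i < n ] 1 ≡ n
∑-ones zero    = refl
∑-ones (suc n) = cong suc (∑-ones n)

∑-≤1 : ∀ n (f : Fin n → ℕ) → (∀ i → f i ≤ 1) → ∑[ i < n ] f i ≤ n
∑-≤1 n f f≤1 = subst (∑[ i < n ] f i ≤_) (∑-ones n) (∑-mono n f≤1)

term≤∑ : ∀ {n} (f : Fin n → ℕ) i → f i ≤ ∑[ j < n ] f j
term≤∑ f fz     = m≤m+n (f fz) _
term≤∑ f (fs i) = ≤-trans (term≤∑ (f ∘ fs) i) (m≤n+m _ (f fz))

∑-select : ∀ {n} (t : Fin n) (x : Fin n → ℕ) → ∑[ b < n ] (𝟙 (t ≟ᶠ b) * x b) ≡ x t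
∑-select {suc n} fz     x = trans (cong₂ _+_ (+-identityʳ (x fz)) (sum-replicate-zero n)) (+-identityʳ (x fz))
∑-select {suc n} (fs t) x =
  trans (sum-cong-≗ (λ b → cong (_* x (fs b)) (𝟙-cong (fs t ≟ᶠ fs b) (t ≟ᶠ b) fs-injective (cong fs))))
        (∑-select t (x ∘ fs))

sum-tabulate : ∀ {n} (f : Fin n → ℕ) → sumˡ (tabulate f) ≡ ∑[ i < n ] f i
sum-tabulate {zero}  f = refl
sum-tabulate {suc n} f = cong (f fz +_) (sum-tabulate (f ∘ fs))

sum-allFin : ∀ n (f : Fin n → ℕ) → sumˡ (map f (allFin n)) ≡ ∑[ i < n ] f i
sum-allFin n f = trans (cong sumˡ (map-tabulate id f)) (sum-tabulate f)

length-filter-tabulate : ∀ {a p} {A : Set a} {P : Pred A p} (P? : Decidable P) {n} (f : Fin n → A) →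
                         length (filter P? (tabulate f)) ≡ ∑[ i < n ] 𝟙 (P? (f i))
length-filter-tabulate P? {zero}  f = refl
length-filter-tabulate P? {suc n} f with P? (f fz)
... | yes _ = cong suc (length-filter-tabulate P? (f ∘ fs))
... | no _  = length-filter-tabulate P? (f ∘ fs)

⊔-tabulate-lub : ∀ {n} (f : Fin n → ℕ) {X} → (∀ i → f i ≤ X) → foldr _⊔_ 0 (tabulate f) ≤ X
⊔-tabulate-lub {zero}  f f≤X = z≤n
⊔-tabulate-lub {suc n} f f≤X = ⊔-lub (f≤X fz) (⊔-tabulate-lub (f ∘ fs) (f≤X ∘ fs))

weight : ∀ {n} → (Fin n → ℕ) → Fin n → ℕ
weight l k = suc (toℕ k) * l k

∑weight : ∀ n (l : Fin n → ℕ) → IsNumPartition n l → ∑[ k < n ] weight l k ≡ n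
∑weight n l isPart = trans (sym (sum-allFin n (weight l))) isPart

maxKL-lub : ∀ n (l : Fin n → ℕ) {X} → (∀ k → weight l k ≤ X) → maxKL n l ≤ X
maxKL-lub n l {X} k≤X =
  subst (_≤ X) (sym (cong (foldr _⊔_ 0) (map-tabulate id (weight l)))) (⊔-tabulate-lub (weight l) k≤X)

weight≤n : ∀ n l → IsNumPartition n l → ∀ k → weight l k ≤ n
weight≤n n l isPart k = subst (weight l k ≤_) (∑weight n l isPart) (term≤∑ (weight l) k)

part≤n : ∀ n l → IsNumPartition n l → ∀ k → l k ≤ n
part≤n n l isPart k = ≤-trans (m≤n*m (l k) (suc (toℕ k))) (weight≤n n l isPart k)

maxKL≤n : ∀ n l → IsNumPartition n l → maxKL n l ≤ n
maxKL≤n n l isPart = maxKL-lub n l (weight≤n n l isPart)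

descents : ∀ {n} → (Fin n → ℕ) → Permutation′ n → ℕ
descents {n} v α = ∑[ i < n ] 𝟙 (v (α ⟨$⟩ʳ i) <? v i)

level : ∀ {n} → (Fin n → ℕ) → ℕ → ℕ
level {n} v s = ∑[ i < n ] 𝟙 (v i ≟ s)

-- A descent from a value ≥ s lands strictly above s.
descent-above : ∀ s a b → 𝟙 (a <? b) + 𝟙 (s ≤? a) ≤ 1 + 𝟙 (s <? b)
descent-above s a b with a <? b | s ≤? a
... | yes a<b | yes s≤a = ≤-reflexive (cong suc (sym (𝟙-yes (s <? b) (≤-<-trans s≤a a<b))))
... | yes _   | no _    = m≤m+n 1 _
... | no _    | yes _   = m≤m+n 1 _
... | no _    | no _    = z≤n

≤-split : ∀ s b → 𝟙 (s ≤? b) ≡ 𝟙 (b ≟ s) + 𝟙 (s <? b)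
≤-split s b with b ≟ s
... | yes refl = trans (𝟙-yes (s ≤? s) ≤-refl) (cong suc (sym (𝟙-no (s <? s) (<-irrefl refl))))
... | no b≢s   = 𝟙-cong (s ≤? b) (s <? b) (λ s≤b → ≤∧≢⇒< s≤b (b≢s ∘ sym)) <⇒≤

-- Summing descent-above over i
-- bounds descents + #{v ∘ α ≥ s} by n + #{v > s}, and α does not change
-- the number of indices with value ≥ s.
level+descents≤n : ∀ {n} (v : Fin n → ℕ) (α : Permutation′ n) s → level v s + descents v α ≤ n
level+descents≤n {n} v α s = +-cancelʳ-≤ above (level v s + descents v α) n (begin
    level v s + descents v α + above
      ≡⟨ trans (cong (_+ above) (+-comm (level v s) (descents v α))) (+-assoc (descents v α) (level v s) above) ⟩
    descents v α + (level v s + above)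
      ≡⟨ cong (descents v α +_) (trans (sym atLeast≡) (∑-permute (λ i → 𝟙 (s ≤? v i)) α)) ⟩
    descents v α + ∑[ i < n ] 𝟙 (s ≤? v (α ⟨$⟩ʳ i))
      ≡⟨ ∑-distrib-+ (λ i → 𝟙 (v (α ⟨$⟩ʳ i) <? v i)) (λ i → 𝟙 (s ≤? v (α ⟨$⟩ʳ i))) ⟨
    ∑[ i < n ] (𝟙 (v (α ⟨$⟩ʳ i) <? v i) + 𝟙 (s ≤? v (α ⟨$⟩ʳ i)))
      ≤⟨ ∑-mono n (λ i → descent-above s (v (α ⟨$⟩ʳ i)) (v i)) ⟩
    ∑[ i < n ] (1 + 𝟙 (s <? v i))
      ≡⟨ ∑-distrib-+ (λ _ → 1) (λ i → 𝟙 (s <? v i)) ⟩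
    ∑[ i < n ] 1 + above
      ≡⟨ cong (_+ above) (∑-ones n) ⟩
    n + above ∎)
  where
  open ≤-Reasoning
  above : ℕ
  above = ∑[ i < n ] 𝟙 (s <? v i)
  atLeast≡ : ∑[ i < n ] 𝟙 (s ≤? v i) ≡ level v s + above
  atLeast≡ = trans (sum-cong-≗ (λ i → ≤-split s (v i))) (∑-distrib-+ (λ i → 𝟙 (v i ≟ s)) (λ i → 𝟙 (s <? v i)))

∑-hit : ∀ m x → 1 ≤ x → x ≤ m → ∑[ k < m ] 𝟙 (x ≟ suc (toℕ k)) ≡ 1
∑-hit m x 1≤x x≤m = trans (sum-cong-≗ {m} (λ k → trans hit⇔ (sym (*-identityʳ _)))) (∑-select t (λ _ → 1))
  where
  x-1<m : x ∸ 1 < m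
  x-1<m = subst (_≤ m) (sym (m+[n∸m]≡n 1≤x)) x≤m
  t : Fin m
  t = fromℕ< x-1<m
  hit⇔ : ∀ {k} → 𝟙 (x ≟ suc (toℕ k)) ≡ 𝟙 (t ≟ᶠ k)
  hit⇔ {k} = 𝟙-cong (x ≟ suc (toℕ k)) (t ≟ᶠ k)
    (λ x≡ → toℕ-injective (trans (toℕ-fromℕ< x-1<m) (cong (_∸ 1) x≡)))
    (λ { refl → trans (sym (m+[n∸m]≡n 1≤x)) (cong suc (sym (toℕ-fromℕ< x-1<m))) })

∑-levels : ∀ {n} m (v : Fin n → ℕ) → (∀ i → 1 ≤ v i) → (∀ i → v i ≤ m) →
           ∑[ k < m ] level v (suc (toℕ k)) ≡ n
∑-levels {n} m v 1≤v v≤m = begin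
  ∑[ k < m ] ∑[ i < n ] 𝟙 (v i ≟ suc (toℕ k))  ≡⟨ ∑-comm {m} {n} (λ k i → 𝟙 (v i ≟ suc (toℕ k))) ⟩
  ∑[ i < n ] ∑[ k < m ] 𝟙 (v i ≟ suc (toℕ k))  ≡⟨ sum-cong-≗ (λ i → ∑-hit m (v i) (1≤v i) (v≤m i)) ⟩
  ∑[ i < n ] 1                                 ≡⟨ ∑-ones n ⟩
  n                                            ∎
  where open ≡-Reasoning

*-𝟙-≟ : ∀ c K → c * 𝟙 (c ≟ K) ≡ K * 𝟙 (c ≟ K)
*-𝟙-≟ c K with c ≟ K
... | yes refl = refl
... | no _     = trans (*-zeroʳ c) (sym (*-zeroʳ K))

Dcard≡descents : ∀ {n} (π : SetPartition n) α → Dcard π α ≡ descents (blockSize π) α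
Dcard≡descents π α = length-filter-tabulate (λ i → blockSize π (α ⟨$⟩ʳ i) <? blockSize π i) id

-- The type of a set partition π of Fin n: type k is the number of blocks of
-- size k + 1 (blocks are indexed by their labels b : Fin n).
module PartitionType {n : ℕ} (π : SetPartition n) where

  -- the size of the block labelled b (0 for an unused label)
  blockCount : Fin n → ℕ
  blockCount b = ∑[ j < n ] 𝟙 (π j ≟ᶠ b)

  blockSize≡ : ∀ i → blockSize π i ≡ blockCount (π i)
  blockSize≡ i = length-filter-tabulate (λ j → π j ≟ᶠ π i) id

  type : Fin n → ℕ
  type k = ∑[ b < n ] 𝟙 (blockCount b ≟ suc (toℕ k))

  -- Counting the elements lying in blocks of size K block by block.
  weight-type : ∀ k → weight type k ≡ level (blockSize π) (suc (toℕ k))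
  weight-type k = sym (begin
    ∑[ i < n ] 𝟙 (blockSize π i ≟ K)                 ≡⟨ sum-cong-≗ (λ i → cong (λ c → 𝟙 (c ≟ K)) (blockSize≡ i)) ⟩
    ∑[ i < n ] 𝟙 (blockCount (π i) ≟ K)              ≡⟨ sum-cong-≗ (λ i → ∑-select (π i) isK) ⟨
    ∑[ i < n ] ∑[ b < n ] (𝟙 (π i ≟ᶠ b) * isK b)     ≡⟨ ∑-comm {n} {n} (λ i b → 𝟙 (π i ≟ᶠ b) * isK b) ⟩
    ∑[ b < n ] ∑[ i < n ] (𝟙 (π i ≟ᶠ b) * isK b)     ≡⟨ sum-cong-≗ (λ b → *-distribʳ-sum (isK b) (λ i → 𝟙 (π i ≟ᶠ b))) ⟨
    ∑[ b < n ] (blockCount b * isK b)                ≡⟨ sum-cong-≗ (λ b → *-𝟙-≟ (blockCount b) K) ⟩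
    ∑[ b < n ] (K * isK b)                           ≡⟨ *-distribˡ-sum K isK ⟨
    K * type k                                       ∎)
    where
    open ≡-Reasoning
    K : ℕ
    K = suc (toℕ k)
    isK : Fin n → ℕ
    isK b = 𝟙 (blockCount b ≟ K)

  1≤blockSize : ∀ i → 1 ≤ blockSize π i
  1≤blockSize i = subst (1 ≤_) (sym (blockSize≡ i))
    (subst (_≤ blockCount (π i)) (𝟙-yes (π i ≟ᶠ π i) refl) (term≤∑ (λ j → 𝟙 (π j ≟ᶠ π i)) i))

  blockSize≤n : ∀ i → blockSize π i ≤ n
  blockSize≤n i = subst (_≤ n) (sym (blockSize≡ i)) (∑-≤1 n _ (λ j → 𝟙≤1 (π j ≟ᶠ π i)))

  type-isNumPartition : IsNumPartition n type
  type-isNumPartition = begin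
    sumˡ (map (weight type) (allFin n))             ≡⟨ sum-allFin n (weight type) ⟩
    ∑[ k < n ] weight type k                        ≡⟨ sum-cong-≗ weight-type ⟩
    ∑[ k < n ] level (blockSize π) (suc (toℕ k))    ≡⟨ ∑-levels n (blockSize π) 1≤blockSize blockSize≤n ⟩
    n                                               ∎
    where open ≡-Reasoning

  Dcard≤ : ∀ α → Dcard π α ≤ n ∸ maxKL n type
  Dcard≤ α = m+n≤o⇒m≤o∸n (Dcard π α) (subst (_≤ n) (+-comm (maxKL n type) (Dcard π α)) maxKL+Dcard≤n)
    where
    Dcard≤n : Dcard π α ≤ n
    Dcard≤n = subst (_≤ n) (sym (Dcard≡descents π α))
                (∑-≤1 n _ (λ i → 𝟙≤1 (blockSize π (α ⟨$⟩ʳ i) <? blockSize π i)))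
    weight≤n∸Dcard : ∀ k → weight type k ≤ n ∸ Dcard π α
    weight≤n∸Dcard k = m+n≤o⇒m≤o∸n (weight type k)
      (subst₂ (λ a b → a + b ≤ n) (sym (weight-type k)) (sym (Dcard≡descents π α))
        (level+descents≤n (blockSize π) α (suc (toℕ k))))
    maxKL+Dcard≤n : maxKL n type + Dcard π α ≤ n
    maxKL+Dcard≤n = m≤o∸n⇒m+n≤o (maxKL n type) Dcard≤n (maxKL-lub n type weight≤n∸Dcard)

argmin≤ : ∀ b (G : ℕ → ℕ) → Σ ℕ λ v → v ≤ b × (∀ u → u ≤ b → G v ≤ G u)
argmin≤ zero    G = 0 , z≤n , λ { zero _ → ≤-refl }
argmin≤ (suc b) G with argmin≤ b G
... | v , v≤b , v-min with G v ≤? G (suc b)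
...   | yes Gv≤ = v , m≤n⇒m≤1+n v≤b , minimal
  where
  minimal : ∀ u → u ≤ suc b → G v ≤ G u
  minimal u u≤1+b with m≤n⇒m<n∨m≡n u≤1+b
  ... | inj₁ u≤b  = v-min u (≤-pred u≤b)
  ... | inj₂ refl = Gv≤
...   | no Gv≰ = suc b , ≤-refl , minimal
  where
  minimal : ∀ u → u ≤ suc b → G (suc b) ≤ G u
  minimal u u≤1+b with m≤n⇒m<n∨m≡n u≤1+b
  ... | inj₁ u≤b  = ≤-trans (<⇒≤ (≰⇒> Gv≰)) (v-min u (≤-pred u≤b))
  ... | inj₂ refl = ≤-refl

_◂_ : ∀ {n} → ℕ → (Fin n → ℕ) → Fin (suc n) → ℕ
(v ◂ g) fz     = v
(v ◂ g) (fs i) = g i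

-- Minimise
-- over the first entry the minimum over the remaining ones.
argminTuple : ∀ n b (F : (Fin n → ℕ) → ℕ) → (∀ g h → (∀ i → g i ≡ h i) → F g ≡ F h) →
              Σ (Fin n → ℕ) λ g → ∀ h → (∀ i → h i ≤ b) → F g ≤ F h
argminTuple zero    b F F-cong = (λ ()) , λ h _ → ≤-reflexive (F-cong _ h (λ ()))
argminTuple (suc n) b F F-cong = (v ◂ rest v) , minimal
  where
  restMin : ∀ v → Σ (Fin n → ℕ) λ g → ∀ h → (∀ i → h i ≤ b) → F (v ◂ g) ≤ F (v ◂ h)
  restMin v = argminTuple n b (λ g → F (v ◂ g)) (λ g h g≗h → F-cong _ _ (λ { fz → refl ; (fs i) → g≗h i }))
  rest : ℕ → Fin n → ℕ
  rest v = proj₁ (restMin v)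
  v : ℕ
  v = proj₁ (argmin≤ b (λ u → F (u ◂ rest u)))
  minimal : ∀ h → (∀ i → h i ≤ b) → F (v ◂ rest v) ≤ F h
  minimal h h≤b = begin
    F (v ◂ rest v)                 ≤⟨ proj₂ (proj₂ (argmin≤ b (λ u → F (u ◂ rest u)))) (h fz) (h≤b fz) ⟩
    F (h fz ◂ rest (h fz))         ≤⟨ proj₂ (restMin (h fz)) (h ∘ fs) (h≤b ∘ fs) ⟩
    F (h fz ◂ (h ∘ fs))            ≡⟨ F-cong _ _ (λ { fz → refl ; (fs i) → refl }) ⟩
    F h                            ∎
    where open ≤-Reasoning

penalise : ℕ → ℕ → ℕ → ℕ
penalise n s c with s ≟ n
... | yes _ = c
... | no _  = suc n

penalise-yes : ∀ n s c → s ≡ n → penalise n s c ≡ c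
penalise-yes n s c s≡n with s ≟ n
... | yes _   = refl
... | no s≢n  = contradiction s≡n s≢n

penalise≤n : ∀ n s c → penalise n s c ≤ n → s ≡ n
penalise≤n n s c ≤n with s ≟ n
... | yes s≡n = s≡n
... | no _    = contradiction ≤n (<-irrefl refl)

objective : ∀ n → (Fin n → ℕ) → ℕ
objective n l = penalise n (sumˡ (map (weight l) (allFin n))) (maxKL n l)

objective-cong : ∀ n g h → (∀ i → g i ≡ h i) → objective n g ≡ objective n h
objective-cong n g h g≗h = cong₂ (penalise n) (cong sumˡ weights≡) (cong (foldr _⊔_ 0) weights≡)
  where
  weights≡ : map (weight g) (allFin n) ≡ map (weight h) (allFin n)
  weights≡ = map-cong (λ k → cong (suc (toℕ k) *_) (g≗h k)) (allFin n)

-- The minimum m of max_k k·l_k over the numerical partitions l of n exists: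
-- parts are ≤ n, so it is the minimum of the objective over tuples bounded by n,
-- and that minimum is a partition because one partition (the type of the
-- discrete partition) scores ≤ n.
minMaxKL-exists : ∀ n → ∃[ m ] IsMinMaxKL n m
minMaxKL-exists n = maxKL n l* , minimal , l* , l*-isPart , refl
  where
  open PartitionType {n} id using (type; type-isNumPartition)
  opt = argminTuple n n (objective n) (objective-cong n)
  l* : Fin n → ℕ
  l* = proj₁ opt
  below : ∀ l → IsNumPartition n l → objective n l* ≤ maxKL n l
  below l isPart = ≤-trans (proj₂ opt l (part≤n n l isPart)) (≤-reflexive (penalise-yes n _ _ isPart))
  l*-isPart : IsNumPartition n l*
  l*-isPart = penalise≤n n _ _ (≤-trans (below type type-isNumPartition) (maxKL≤n n type type-isNumPartition))
  minimal : ∀ l → IsNumPartition n l → maxKL n l* ≤ maxKL n l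
  minimal l isPart = subst (_≤ maxKL n l) (penalise-yes n _ _ l*-isPart) (below l isPart)

-- Consecutive segments of lengths w 0, w 1, … laid out on ℕ: segment k is
-- [origin w k, origin w (suc k)).
origin : (ℕ → ℕ) → ℕ → ℕ
origin w zero    = 0
origin w (suc k) = w 0 + origin (w ∘ suc) k

origin-suc : ∀ w k → origin w (suc k) ≡ origin w k + w k
origin-suc w zero    = +-identityʳ (w 0)
origin-suc w (suc k) = trans (cong (w 0 +_) (origin-suc (w ∘ suc) k)) (sym (+-assoc (w 0) _ _))

origin-mono : ∀ w {k k′} → k ≤ k′ → origin w k ≤ origin w k′
origin-mono w z≤n       = z≤n
origin-mono w (s≤s k≤k′) = +-monoʳ-≤ (w 0) (origin-mono (w ∘ suc) k≤k′)

locate : ℕ → (ℕ → ℕ) → ℕ → ℕ × ℕ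
locate zero    w q = 0 , q
locate (suc n) w q with q <? w 0
... | yes _ = 0 , q
... | no _  = map₁ suc (locate n (w ∘ suc) (q ∸ w 0))

segment : ℕ → (ℕ → ℕ) → ℕ → ℕ
segment n w q = proj₁ (locate n w q)

offset : ℕ → (ℕ → ℕ) → ℕ → ℕ
offset n w q = proj₂ (locate n w q)

∸-<-cancel : ∀ {a q p} → a ≤ q → q < a + p → q ∸ a < p
∸-<-cancel {a} a≤q q<a+p = +-cancelˡ-< a _ _ (subst (_< a + _) (sym (m+[n∸m]≡n a≤q)) q<a+p)

locate-sound : ∀ n w q → q < origin w n →
  segment n w q < n × offset n w q < w (segment n w q) × q ≡ origin w (segment n w q) + offset n w q
locate-sound (suc n) w q q<origin with q <? w 0
... | yes q<w0 = s≤s z≤n , q<w0 , refl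
... | no q≮w0 with locate-sound n (w ∘ suc) (q ∸ w 0) (∸-<-cancel (≮⇒≥ q≮w0) q<origin)
...   | k<n , o<w , q-w0≡ = s≤s k<n , o<w ,
  trans (sym (m+[n∸m]≡n (≮⇒≥ q≮w0))) (trans (cong (w 0 +_) q-w0≡) (sym (+-assoc (w 0) _ _)))

locate-complete : ∀ n w k o → k < n → o < w k → locate n w (origin w k + o) ≡ (k , o)
locate-complete (suc n) w zero    o _ o<w with o <? w 0
... | yes _   = refl
... | no o≮w = contradiction o<w o≮w
locate-complete (suc n) w (suc k) o (s≤s k<n) o<w with (w 0 + origin (w ∘ suc) k) + o <? w 0
... | yes q<w0 = contradiction q<w0 (≤⇒≯ (≤-trans (m≤m+n (w 0) _) (m≤m+n _ o)))
... | no _     = cong (map₁ suc) (trans (cong (locate n (w ∘ suc)) shifted)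
                                        (locate-complete n (w ∘ suc) k o k<n o<w))
  where
  shifted : (w 0 + origin (w ∘ suc) k) + o ∸ w 0 ≡ origin (w ∘ suc) k + o
  shifted = trans (cong (_∸ w 0) (+-assoc (w 0) _ o)) (m+n∸m≡n (w 0) _)

segment-< : ∀ n w q k → k ≤ n → q < origin w k → segment n w q < k
segment-< n w q k k≤n q<origin = ≰⇒> λ k≤seg → <⇒≱ q<origin (begin
    origin w k                                         ≤⟨ origin-mono w k≤seg ⟩
    origin w (segment n w q)                           ≤⟨ m≤m+n _ _ ⟩
    origin w (segment n w q) + offset n w q            ≡⟨ proj₂ (proj₂ located) ⟨
    q                                                  ∎)
  where
  open ≤-Reasoning
  located = locate-sound n w q (<-≤-trans q<origin (origin-mono w k≤n))

count-below : ∀ n a → a ≤ n → ∑[ j < n ] 𝟙 (toℕ j <? a) ≡ a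
count-below n       zero    _         = sum-replicate-zero n
count-below (suc n) (suc a) (s≤s a≤n) =
  cong suc (trans (sum-cong-≗ {n} (λ j → 𝟙-cong (suc (toℕ j) <? suc a) (toℕ j <? a) ≤-pred s≤s)) (count-below n a a≤n))

below-split : ∀ a b x → a ≤ b → 𝟙 (x <? b) ≡ 𝟙 (x <? a) + 𝟙 ((a ≤? x) ×-dec (x <? b))
below-split a b x a≤b with x <? a | a ≤? x
... | yes x<a | yes a≤x = contradiction a≤x (<⇒≱ x<a)
... | yes x<a | no _    = trans (𝟙-yes (x <? b) (<-≤-trans x<a a≤b)) (sym (+-identityʳ 1))
... | no _    | yes a≤x = 𝟙-cong (x <? b) ((yes a≤x) ×-dec (x <? b)) (a≤x ,_) proj₂
... | no x≮a  | no a≰x  = contradiction (≮⇒≥ x≮a) a≰x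

count-interval : ∀ n a b → a ≤ b → b ≤ n → ∑[ j < n ] 𝟙 ((a ≤? toℕ j) ×-dec (toℕ j <? b)) ≡ b ∸ a
count-interval n a b a≤b b≤n = begin
  inside                                                       ≡⟨ m+n∸m≡n below-a inside ⟨
  below-a + inside ∸ below-a                                   ≡⟨ cong (_∸ below-a) split ⟨
  ∑[ j < n ] 𝟙 (toℕ j <? b) ∸ below-a                          ≡⟨ cong₂ _∸_ (count-below n b b≤n) (count-below n a (≤-trans a≤b b≤n)) ⟩
  b ∸ a                                                        ∎
  where
  open ≡-Reasoning
  below-a inside : ℕ
  below-a = ∑[ j < n ] 𝟙 (toℕ j <? a)
  inside  = ∑[ j < n ] 𝟙 ((a ≤? toℕ j) ×-dec (toℕ j <? b))
  split : ∑[ j < n ] 𝟙 (toℕ j <? b) ≡ below-a + inside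
  split = trans (sum-cong-≗ {n} (λ j → below-split a b (toℕ j) a≤b)) (∑-distrib-+ {n} _ _)

[t*K+r]/K≡t : ∀ t K .{{_ : NonZero K}} r → r < K → (t * K + r) / K ≡ t
[t*K+r]/K≡t t K r r<K = begin
  (t * K + r) / K       ≡⟨ +-distrib-/-∣ˡ r (n∣m*n t) ⟩
  t * K / K + r / K     ≡⟨ cong₂ _+_ (m*n/n≡m t K) (m<n⇒m/n≡0 r<K) ⟩
  t + 0                 ≡⟨ +-identityʳ t ⟩
  t                     ∎
  where open ≡-Reasoning

rotate : ∀ N .{{_ : NonZero N}} → ℕ → Fin N → Fin N
rotate N d i = fromℕ< (m%n<n (toℕ i + d) N)

toℕ-rotate : ∀ N .{{_ : NonZero N}} d i → toℕ (rotate N d i) ≡ (toℕ i + d) % N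
toℕ-rotate N d i = toℕ-fromℕ< (m%n<n (toℕ i + d) N)

rotate-inverse : ∀ N .{{_ : NonZero N}} c d → c + d ≡ N → ∀ i → rotate N d (rotate N c i) ≡ i
rotate-inverse N c d c+d≡N i = toℕ-injective (begin
  toℕ (rotate N d (rotate N c i))    ≡⟨ toℕ-rotate N d (rotate N c i) ⟩
  (toℕ (rotate N c i) + d) % N       ≡⟨ cong (λ z → (z + d) % N) (toℕ-rotate N c i) ⟩
  ((x + c) % N + d) % N              ≡⟨ %-distribˡ-+ ((x + c) % N) d N ⟩
  ((x + c) % N % N + d % N) % N      ≡⟨ cong (λ z → (z + d % N) % N) (m%n%n≡m%n (x + c) N) ⟩
  ((x + c) % N + d % N) % N          ≡⟨ %-distribˡ-+ (x + c) d N ⟨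
  (x + c + d) % N                    ≡⟨ cong (_% N) (trans (+-assoc x c d) (cong (x +_) c+d≡N)) ⟩
  (x + N) % N                        ≡⟨ [m+n]%n≡m%n x N ⟩
  x % N                              ≡⟨ m<n⇒m%n≡m (toℕ<n i) ⟩
  x                                  ∎)
  where
  open ≡-Reasoning
  x : ℕ
  x = toℕ i

rotation : ∀ N .{{_ : NonZero N}} c d → c + d ≡ N → Permutation′ N
rotation N c d c+d≡N =
  permutation (rotate N d) (rotate N c) (rotate-inverse N c d c+d≡N) (rotate-inverse N d c (trans (+-comm d c) c+d≡N))

rotation-back : ∀ N .{{_ : NonZero N}} c d (c+d≡N : c + d ≡ N) i → c ≤ toℕ i →
                toℕ (rotation N c d c+d≡N ⟨$⟩ʳ i) ≡ toℕ i ∸ c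
rotation-back N c d c+d≡N i c≤i = begin
  toℕ (rotate N d i)          ≡⟨ toℕ-rotate N d i ⟩
  (toℕ i + d) % N             ≡⟨ cong (_% N) i+d≡ ⟩
  (toℕ i ∸ c + N) % N         ≡⟨ [m+n]%n≡m%n (toℕ i ∸ c) N ⟩
  (toℕ i ∸ c) % N             ≡⟨ m<n⇒m%n≡m (≤-<-trans (m∸n≤m (toℕ i) c) (toℕ<n i)) ⟩
  toℕ i ∸ c                   ∎
  where
  open ≡-Reasoning
  i+d≡ : toℕ i + d ≡ toℕ i ∸ c + N
  i+d≡ = trans (cong (_+ d) (sym (m∸n+n≡m c≤i))) (trans (+-assoc (toℕ i ∸ c) c d) (cong (toℕ i ∸ c +_) c+d≡N))

extend : ∀ {n} → (Fin n → ℕ) → ℕ → ℕ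
extend {zero}  h k       = 0
extend {suc n} h zero    = h fz
extend {suc n} h (suc k) = extend (h ∘ fs) k

origin-extend : ∀ n (h : Fin n → ℕ) (g : ℕ → ℕ) →
                origin (λ k → g k * extend h k) n ≡ ∑[ k < n ] (g (toℕ k) * h k)
origin-extend zero    h g = refl
origin-extend (suc n) h g = cong (g 0 * h fz +_) (origin-extend n (h ∘ fs) (g ∘ suc))

extend-≤⊔ : ∀ n (h : Fin n → ℕ) (g : ℕ → ℕ) k → g k * extend h k ≤ foldr _⊔_ 0 (tabulate (λ k → g (toℕ k) * h k))
extend-≤⊔ zero    h g k       = ≤-reflexive (*-zeroʳ (g k))
extend-≤⊔ (suc n) h g zero    = m≤m⊔n _ _
extend-≤⊔ (suc n) h g (suc k) = ≤-trans (extend-≤⊔ n (h ∘ fs) (g ∘ suc) k) (m≤n⊔m _ _)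

-- Segment k of [0, N) has length (k+1)·l_k and is cut into
-- l_k consecutive blocks of size k + 1, each labelled by its first point.  The
-- rotation i ↦ i − M (mod N) sends every i ≥ M to an earlier segment, as
-- segments have length ≤ M, hence into a smaller block.
module Realisation (N : ℕ) .{{_ : NonZero N}} (l : Fin N → ℕ) (isPart : IsNumPartition N l) where

  M : ℕ
  M = maxKL N l

  M≤N : M ≤ N
  M≤N = maxKL≤n N l isPart

  w : ℕ → ℕ
  w k = suc k * extend l k

  origin-N : origin w N ≡ N
  origin-N = trans (origin-extend N l suc) (∑weight N l isPart)

  w≤M : ∀ k → w k ≤ M
  w≤M k = subst (w k ≤_) (sym (cong (foldr _⊔_ 0) (map-tabulate id (weight l)))) (extend-≤⊔ N l suc k)

  seg off K : ℕ → ℕ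
  seg q = segment N w q
  off q = offset N w q
  K   q = suc (seg q)

  located : ∀ q → q < N → seg q < N × off q < w (seg q) × q ≡ origin w (seg q) + off q
  located q q<N = locate-sound N w q (subst (q <_) (sym origin-N) q<N)

  blockNo : ℕ → ℕ
  blockNo q = off q / K q

  startOf : ℕ × ℕ → ℕ
  startOf (k , o) = origin w k + o / suc k * suc k

  blockStart : ℕ → ℕ
  blockStart q = startOf (locate N w q)

  block-in-segment : ∀ q → q < N → blockNo q * K q + K q ≤ w (seg q)
  block-in-segment q q<N = begin
    blockNo q * K q + K q    ≡⟨ +-comm (blockNo q * K q) (K q) ⟩
    suc (blockNo q) * K q    ≤⟨ *-monoˡ-≤ (K q) blockNo<count ⟩
    extend l (seg q) * K q   ≡⟨ *-comm (extend l (seg q)) (K q) ⟩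
    w (seg q)                ∎
    where
    open ≤-Reasoning
    blockNo<count : blockNo q < extend l (seg q)
    blockNo<count = m<n*o⇒m/o<n (subst (off q <_) (*-comm (K q) (extend l (seg q))) (proj₁ (proj₂ (located q q<N))))

  locate-block : ∀ q → q < N → ∀ r → r < K q → locate N w (blockStart q + r) ≡ (seg q , blockNo q * K q + r)
  locate-block q q<N r r<K = trans (cong (locate N w) (+-assoc (origin w (seg q)) (blockNo q * K q) r))
    (locate-complete N w (seg q) (blockNo q * K q + r) (proj₁ (located q q<N))
      (<-≤-trans (+-monoʳ-< (blockNo q * K q) r<K) (block-in-segment q q<N)))

  blockStart-block : ∀ q → q < N → ∀ r → r < K q → blockStart (blockStart q + r) ≡ blockStart q
  blockStart-block q q<N r r<K = trans (cong startOf (locate-block q q<N r r<K))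
    (cong (λ t → origin w (seg q) + t * K q) ([t*K+r]/K≡t (blockNo q) (K q) r r<K))

  seg-blockStart : ∀ q → q < N → seg (blockStart q) ≡ seg q
  seg-blockStart q q<N = trans (cong seg (sym (+-identityʳ (blockStart q)))) (cong proj₁ (locate-block q q<N 0 (s≤s z≤n)))

  blockStart-bounds : ∀ q → q < N → blockStart q ≤ q × q < blockStart q + K q
  blockStart-bounds q q<N = subst (blockStart q ≤_) (sym q≡) (m≤m+n (blockStart q) _) ,
                            subst (_< blockStart q + K q) (sym q≡) (+-monoʳ-< (blockStart q) (m%n<n (off q) (K q)))
    where
    q≡ : q ≡ blockStart q + off q % K q
    q≡ = begin
      q                                                     ≡⟨ proj₂ (proj₂ (located q q<N)) ⟩
      origin w (seg q) + off q                              ≡⟨ cong (origin w (seg q) +_) (m≡m%n+[m/n]*n (off q) (K q)) ⟩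
      origin w (seg q) + (off q % K q + blockNo q * K q)     ≡⟨ cong (origin w (seg q) +_) (+-comm (off q % K q) _) ⟩
      origin w (seg q) + (blockNo q * K q + off q % K q)     ≡⟨ +-assoc (origin w (seg q)) _ _ ⟨
      blockStart q + off q % K q                            ∎
      where open ≡-Reasoning

  blockEnd≤N : ∀ q → q < N → blockStart q + K q ≤ N
  blockEnd≤N q q<N = begin
    origin w (seg q) + blockNo q * K q + K q      ≡⟨ +-assoc (origin w (seg q)) _ _ ⟩
    origin w (seg q) + (blockNo q * K q + K q)    ≤⟨ +-monoʳ-≤ (origin w (seg q)) (block-in-segment q q<N) ⟩
    origin w (seg q) + w (seg q)                  ≡⟨ origin-suc w (seg q) ⟨
    origin w (suc (seg q))                        ≤⟨ origin-mono w (proj₁ (located q q<N)) ⟩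
    origin w N                                    ≡⟨ origin-N ⟩
    N                                             ∎
    where open ≤-Reasoning

  π : SetPartition N
  π i = fromℕ< (≤-<-trans (proj₁ (blockStart-bounds (toℕ i) (toℕ<n i))) (toℕ<n i))

  toℕ-π : ∀ i → toℕ (π i) ≡ blockStart (toℕ i)
  toℕ-π i = toℕ-fromℕ< _

  InBlockOf : Fin N → Fin N → Set
  InBlockOf i j = blockStart (toℕ i) ≤ toℕ j × toℕ j < blockStart (toℕ i) + K (toℕ i)

  sameBlock⇒ : ∀ i j → π j ≡ π i → InBlockOf i j
  sameBlock⇒ i j πj≡πi = subst (_≤ toℕ j) starts≡ (proj₁ bounds-j) ,
                         subst (toℕ j <_) (cong₂ _+_ starts≡ (cong suc segs≡)) (proj₂ bounds-j)
    where
    bounds-j = blockStart-bounds (toℕ j) (toℕ<n j)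
    starts≡ : blockStart (toℕ j) ≡ blockStart (toℕ i)
    starts≡ = trans (sym (toℕ-π j)) (trans (cong toℕ πj≡πi) (toℕ-π i))
    segs≡ : seg (toℕ j) ≡ seg (toℕ i)
    segs≡ = trans (sym (seg-blockStart (toℕ j) (toℕ<n j)))
                  (trans (cong seg starts≡) (seg-blockStart (toℕ i) (toℕ<n i)))

  ⇒sameBlock : ∀ i j → InBlockOf i j → π j ≡ π i
  ⇒sameBlock i j (start≤j , j<end) = toℕ-injective (begin
    toℕ (π j)                          ≡⟨ toℕ-π j ⟩
    blockStart (toℕ j)                 ≡⟨ cong blockStart j≡ ⟨
    blockStart (blockStart q + r)      ≡⟨ blockStart-block q (toℕ<n i) r (∸-<-cancel start≤j j<end) ⟩
    blockStart q                       ≡⟨ toℕ-π i ⟨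
    toℕ (π i)                          ∎)
    where
    open ≡-Reasoning
    q r : ℕ
    q = toℕ i
    r = toℕ j ∸ blockStart q
    j≡ : blockStart q + r ≡ toℕ j
    j≡ = m+[n∸m]≡n start≤j

  blockSize-π : ∀ i → blockSize π i ≡ K (toℕ i)
  blockSize-π i = begin
    blockSize π i                                              ≡⟨ length-filter-tabulate (λ j → π j ≟ᶠ π i) id ⟩
    ∑[ j < N ] 𝟙 (π j ≟ᶠ π i)
      ≡⟨ sum-cong-≗ (λ j → 𝟙-cong (π j ≟ᶠ π i) (inBlock? j) (sameBlock⇒ i j) (⇒sameBlock i j)) ⟩
    ∑[ j < N ] 𝟙 (inBlock? j)
      ≡⟨ count-interval N (blockStart q) (blockStart q + K q) (m≤m+n _ _) (blockEnd≤N q (toℕ<n i)) ⟩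
    blockStart q + K q ∸ blockStart q                          ≡⟨ m+n∸m≡n (blockStart q) (K q) ⟩
    K q                                                        ∎
    where
    open ≡-Reasoning
    q : ℕ
    q = toℕ i
    inBlock? : ∀ j → Dec (InBlockOf i j)
    inBlock? j = (blockStart q ≤? toℕ j) ×-dec (toℕ j <? blockStart q + K q)

  α : Permutation′ N
  α = rotation N M (N ∸ M) (m+[n∸m]≡n M≤N)

  -- A segment is shorter than M, so going back M points leaves the segment.
  segment-drops : ∀ q → M ≤ q → q < N → seg (q ∸ M) < seg q
  segment-drops q M≤q q<N =
    segment-< N w (q ∸ M) (seg q) (<⇒≤ seg<N) (∸-<-cancel M≤q (subst (q <_) (+-comm _ M) q<origin+M))
    where
    seg<N = proj₁ (located q q<N)
    q<origin+M : q < origin w (seg q) + M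
    q<origin+M = subst (_< origin w (seg q) + M) (sym (proj₂ (proj₂ (located q q<N))))
                   (+-monoʳ-< (origin w (seg q)) (<-≤-trans (proj₁ (proj₂ (located q q<N))) (w≤M (seg q))))

  descent : ∀ i → M ≤ toℕ i → blockSize π (α ⟨$⟩ʳ i) < blockSize π i
  descent i M≤i = subst₂ _<_ (sym (blockSize-π (α ⟨$⟩ʳ i))) (sym (blockSize-π i))
    (s≤s (subst (λ q → seg q < seg (toℕ i)) (sym (rotation-back N M (N ∸ M) (m+[n∸m]≡n M≤N) i M≤i))
      (segment-drops (toℕ i) M≤i (toℕ<n i))))

  many-descents : N ∸ M ≤ Dcard π α
  many-descents = begin
    N ∸ M                                                        ≡⟨ count-interval N M N M≤N ≤-refl ⟨
    ∑[ i < N ] 𝟙 ((M ≤? toℕ i) ×-dec (toℕ i <? N))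
      ≤⟨ ∑-mono N (λ i → 𝟙-mono _ (blockSize π (α ⟨$⟩ʳ i) <? blockSize π i) (descent i ∘ proj₁)) ⟩
    descents (blockSize π) α                                     ≡⟨ Dcard≡descents π α ⟨
    Dcard π α                                                    ∎
    where open ≤-Reasoning

realise : ∀ n (l : Fin n → ℕ) → IsNumPartition n l → ∃[ π ] ∃[ α ] (n ∸ maxKL n l ≤ Dcard {n} π α)
realise zero       l isPart = (λ ()) , Perm.id , z≤n
realise n@(suc _) l isPart = π , α , many-descents
  where open Realisation n l isPart

mainTheorem13 : ∀ (n : ℕ) → ∃[ m ] (IsMinMaxKL n m × IsDX n (n ∸ m))
mainTheorem13 n with minMaxKL-exists n
... | m , isMin@(minimal , l , isPart , maxKL≡m) = m , isMin , upper , lower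
  where
  upper : ∀ π α → Dcard π α ≤ n ∸ m
  upper π α = ≤-trans (Dcard≤ α) (∸-monoʳ-≤ n (minimal type type-isNumPartition))
    where open PartitionType π
  lower : ∃[ π ] ∃[ α ] Dcard {n} π α ≡ n ∸ m
  lower with realise n l isPart
  ... | π , α , many = π , α , ≤-antisym (upper π α) (subst (λ M → n ∸ M ≤ Dcard π α) maxKL≡m many)
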